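{- Let $\mathcal{M}=(Q,r)$ be a matroid and let $H_1,H_2\subseteq Q$ be hyperplanes of $\mathcal{M}$. Then $\mathcal{M}$ admits a common information (CI) extension for $(H_1,H_2)$.
   Context: Write $AB=A\cup B$, $r(A|B)=r(AB)-r(B)$ and $r(A;B)=r(A)+r(B)-r(AB)$. A flat is a set $F$ with $r(Fx)>r(F)$ for all $x\notin F$; a hyperplane is a flat of rank $r(Q)-1$. An extension of $(Q,r)$ is a polymatroid $(QZ,g)$ with $Q\cap Z=\emptyset$ and $g=r$ on subsets of $Q$. A CI extension for $(X,Y)$ is an extension $(QZ,g)$ with (CI1) $g(Z|X)=g(Z|Y)=0$ and (CI2) $g(Z)=g(X;Y)$. -}

module Defs where

open import Data.Nat as ℕ using (ℕ; _+_)
open import Data.Fin using (Fin)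
open import Data.Fin.Subset using (Subset; ⊥; ⊤; _∪_; _∩_; ⁅_⁆; _∉_; _⊆_; ∣_∣; inside; outside)
open import Data.Integer as ℤ using ()
open import Data.Vec using (_++_; replicate)
open import Data.Rational as ℚ using (ℚ; _-_)
open import Data.Product using (Σ; _×_; ∃-syntax)
open import Relation.Binary.PropositionalEquality using (_≡_)

record IsMatroid {n : ℕ} (r : Subset n → ℕ) : Set where
  field
    bounded    : ∀ A → r A ℕ.≤ ∣ A ∣
    monotone   : ∀ A B → A ⊆ B → r A ℕ.≤ r B
    submodular : ∀ A B → r (A ∪ B) + r (A ∩ B) ℕ.≤ r A + r B

record IsPolymatroid {k : ℕ} (g : Subset k → ℚ) : Set where
  field
    normalized : g ⊥ ≡ ℚ.0ℚ
    monotone   : ∀ A B → A ⊆ B → g A ℚ.≤ g B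
    submodular : ∀ A B → g (A ∪ B) ℚ.+ g (A ∩ B) ℚ.≤ g A ℚ.+ g B

IsFlat : {n : ℕ} → (Subset n → ℕ) → Subset n → Set
IsFlat r F = ∀ x → x ∉ F → r F ℕ.< r (F ∪ ⁅ x ⁆)

IsHyperplane : {n : ℕ} → (Subset n → ℕ) → Subset n → Set
IsHyperplane r H = IsFlat r H × (r H + 1 ≡ r ⊤)

-- The ground set QZ of an extension is Fin (n + m): the first n elements are Q,
-- the last m elements are the new set Z (disjoint from Q).
embedQ : {n m : ℕ} → Subset n → Subset (n + m)
embedQ {n} {m} A = A ++ replicate m outside

Zset : (n m : ℕ) → Subset (n + m)
Zset n m = replicate n outside ++ replicate m inside

toℚ : ℕ → ℚ
toℚ k = (ℤ.+ k) ℚ./ 1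

IsExtension : {n m : ℕ} → (Subset n → ℕ) → (Subset (n + m) → ℚ) → Set
IsExtension r g = IsPolymatroid g × (∀ A → g (embedQ A) ≡ toℚ (r A))

-- CI extension for (X, Y):
-- (CI1) g(Z|X) = g(Z|Y) = 0, (CI2) g(Z) = g(X;Y).
IsCIExtension : {n m : ℕ} → (Subset n → ℕ) → (Subset (n + m) → ℚ) →
                Subset n → Subset n → Set
IsCIExtension {n} {m} r g X Y =
  IsExtension r g ×
  (g (Zset n m ∪ embedQ X) - g (embedQ X) ≡ ℚ.0ℚ) ×
  (g (Zset n m ∪ embedQ Y) - g (embedQ Y) ≡ ℚ.0ℚ) ×
  (g (Zset n m) ≡ (g (embedQ X) ℚ.+ g (embedQ Y)) - g (embedQ X ∪ embedQ Y))

HasCIExtension : {n : ℕ} → (Subset n → ℕ) → Subset n → Subset n → Set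
HasCIExtension {n} r X Y =
  ∃[ m ] Σ (Subset (n + m) → ℚ) λ g → IsCIExtension r g X Y

{-# OPTIONS --safe #-}
-- Adjoin a single element z and give A ∪ z the rank
--   t A = min (r (A ∪ T) + c) (r (A ∪ H₁)) (r (A ∪ H₂)),
-- where T = H₁ ∩ H₂, k = r(H₁;H₂) = r H₁ + r H₂ − r (H₁ ∪ H₂) and c = k − r T ≥ 0.
-- Each bound A ↦ r (A ∪ F) + c is monotone, dominates r, is submodular and satisfies
-- bound (A ∪ B) + r (A ∩ B) ≤ bound A + r B; so the minimum is a valid rank for z as soon
-- as any two bounds i, j satisfy
-- t (A ∪ B) + t (A ∩ B) ≤ boundᵢ A + boundⱼ B.  When one flat lies inside the other
-- (T ⊆ Hᵢ) this is submodularity of r; for H₁ against H₂ it uses that a hyperplane H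
-- either contains A or r (A ∪ H) = r Q.  Then t Hᵢ = r Hᵢ gives (CI1) and t ∅ = k gives (CI2).
module Submission where

open import Defs
open import Data.Nat using (ℕ; zero; suc; _+_; _∸_; _⊓_; _≤_)
import Data.Nat.Properties as ℕP
open import Data.Bool using (_∨_; _∧_)
open import Data.Fin.Subset
  using (Subset; ⊥; ⊤; _∪_; _∩_; ∁; ⁅_⁆; _∈_; _⊆_; inside; outside)
open import Data.Fin.Subset.Properties
  using ( ⊆-refl; ⊆-trans; ⊆-antisym; ⊆⊤; ⊥⊆; p⊆p∪q; q⊆p∪q; p∩q⊆p; p∩q⊆q
        ; _∈?_; x∈p∪q⁻; x∈p∩q⁺; x∈∁p⇒x∉p; x∉p⇒x∈∁p; x∈⁅y⁆⇒x≡y; nonempty?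
        ; ∪-comm; ∩-comm; ∪-idem; ∪-identityˡ; ∣⊥∣≡0)
open import Data.Vec using (Vec; []; _∷_; _++_; take; drop)
open import Data.Vec.Properties
  using (take-zipWith; drop-zipWith; take++drop≡id; ++-injectiveˡ; ++-injectiveʳ; zipWith-++)
open import Data.Integer as ℤ using (+_)
import Data.Integer.Properties as ℤP
open import Data.Rational as ℚ using (ℚ; mkℚ; _-_)
import Data.Rational.Properties as ℚP
open import Data.Nat.Coprimality using (1-coprimeTo) renaming (sym to coprime-sym)
open import Algebra.Properties.Group ℚP.+-0-group using (//-rightDividesʳ)
open import Algebra.Properties.CommutativeSemigroup ℕP.+-commutativeSemigroup using (interchange)
open import Data.Product using (_,_)
open import Data.Sum using (_⊎_; inj₁; inj₂)
open import Relation.Nullary using (yes; no; contradiction)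
open import Relation.Binary.PropositionalEquality

private
  variable
    n m : ℕ
    p q s p′ q′ : Subset n

toℚ≡mkℚ : ∀ k → toℚ k ≡ mkℚ (+ k) 0 (coprime-sym (1-coprimeTo k))
toℚ≡mkℚ k = ℚP.normalize-coprime (coprime-sym (1-coprimeTo k))

toℚ-+ : ∀ a b → toℚ (a + b) ≡ toℚ a ℚ.+ toℚ b
toℚ-+ a b = begin
  toℚ (a + b)                          ≡⟨ cong (ℚ._/ 1) (cong₂ ℤ._+_ (ℤP.*-identityʳ (+ a)) (ℤP.*-identityʳ (+ b))) ⟨
  (+ a ℤ.* + 1 ℤ.+ + b ℤ.* + 1) ℚ./ 1 ≡⟨ cong₂ ℚ._+_ (toℚ≡mkℚ a) (toℚ≡mkℚ b) ⟨
  toℚ a ℚ.+ toℚ b                      ∎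
  where open ≡-Reasoning

toℚ-mono-≤ : ∀ {a b} → a ≤ b → toℚ a ℚ.≤ toℚ b
toℚ-mono-≤ {a} {b} a≤b = subst₂ ℚ._≤_ (sym (toℚ≡mkℚ a)) (sym (toℚ≡mkℚ b))
  (ℚ.*≤* (ℤP.*-monoʳ-≤-nonNeg (+ 1) (ℤ.+≤+ a≤b)))

toℚ-cancel : ∀ a b {c} → a + b ≡ c → toℚ a ≡ toℚ c - toℚ b
toℚ-cancel a b {c} a+b≡c = begin
  toℚ a                      ≡⟨ //-rightDividesʳ (toℚ b) (toℚ a) ⟨
  (toℚ a ℚ.+ toℚ b) - toℚ b  ≡⟨ cong (_- toℚ b) (toℚ-+ a b) ⟨
  toℚ (a + b) - toℚ b        ≡⟨ cong (λ x → toℚ x - toℚ b) a+b≡c ⟩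
  toℚ c - toℚ b              ∎
  where open ≡-Reasoning

IsMonotone : (Subset n → ℕ) → Set
IsMonotone f = ∀ A B → A ⊆ B → f A ≤ f B

IsSubmodular : (Subset n → ℕ) → Set
IsSubmodular f = ∀ A B → f (A ∪ B) + f (A ∩ B) ≤ f A + f B

∪-least : p ⊆ s → q ⊆ s → p ∪ q ⊆ s
∪-least {p = p} {q = q} p⊆s q⊆s x∈p∪q with x∈p∪q⁻ p q x∈p∪q
... | inj₁ x∈p = p⊆s x∈p
... | inj₂ x∈q = q⊆s x∈q

∩-greatest : s ⊆ p → s ⊆ q → s ⊆ p ∩ q
∩-greatest s⊆p s⊆q x∈s = x∈p∩q⁺ (s⊆p x∈s , s⊆q x∈s)

∪-mono-⊆ : p ⊆ p′ → q ⊆ q′ → p ∪ q ⊆ p′ ∪ q′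
∪-mono-⊆ {p′ = p′} {q′ = q′} p⊆p′ q⊆q′ =
  ∪-least (⊆-trans p⊆p′ (p⊆p∪q q′)) (⊆-trans q⊆q′ (q⊆p∪q p′ q′))

∩-mono-⊆ : p ⊆ p′ → q ⊆ q′ → p ∩ q ⊆ p′ ∩ q′
∩-mono-⊆ {p = p} {q = q} p⊆p′ q⊆q′ =
  ∩-greatest (⊆-trans (p∩q⊆p p q) p⊆p′) (⊆-trans (p∩q⊆q p q) q⊆q′)

⊆⇒∪≡ : p ⊆ q → p ∪ q ≡ q
⊆⇒∪≡ {p = p} {q = q} p⊆q = ⊆-antisym (∪-least p⊆q ⊆-refl) (q⊆p∪q p q)

x∈p⇒⁅x⁆⊆p : ∀ {x} → x ∈ p → ⁅ x ⁆ ⊆ p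
x∈p⇒⁅x⁆⊆p {p = p} {x = x} x∈p y∈⁅x⁆ = subst (_∈ p) (sym (x∈⁅y⁆⇒x≡y x y∈⁅x⁆)) x∈p

take-++ : ∀ {A : Set} (xs : Vec A n) (ys : Vec A m) → take n (xs ++ ys) ≡ xs
take-++ {n = n} xs ys = ++-injectiveˡ _ xs (take++drop≡id n (xs ++ ys))

drop-++ : ∀ {A : Set} (xs : Vec A n) (ys : Vec A m) → drop n (xs ++ ys) ≡ ys
drop-++ {n = n} xs ys = ++-injectiveʳ _ xs (take++drop≡id n (xs ++ ys))

⊥-++ : ∀ n → ⊥ {n + m} ≡ ⊥ {n} ++ ⊥ {m}
⊥-++ zero    = refl
⊥-++ (suc n) = cong (outside ∷_) (⊥-++ n)

glue : (Subset n → Subset m → ℕ) → Subset (n + m) → ℚ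
glue {n} h S = toℚ (h (take n S) (drop n S))

glue-++ : ∀ (h : Subset n → Subset m → ℕ) A z → glue h (A ++ z) ≡ toℚ (h A z)
glue-++ h A z = cong₂ (λ A z → toℚ (h A z)) (take-++ A z) (drop-++ A z)

glue-isPolymatroid : (h : Subset n → Subset m → ℕ) → h ⊥ ⊥ ≡ 0 →
  (∀ A B z w → h A z ≤ h (A ∪ B) (z ∪ w)) →
  (∀ A B z w → h (A ∪ B) (z ∪ w) + h (A ∩ B) (z ∩ w) ≤ h A z + h B w) →
  IsPolymatroid (glue h)
glue-isPolymatroid {n} {m} h h-⊥ h-increasing h-submodular = record
  { normalized = trans (cong (glue h) (⊥-++ n)) (trans (glue-++ h ⊥ ⊥) (cong toℚ h-⊥))
  ; monotone   = glue-monotone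
  ; submodular = glue-submodular
  }
  where
  glue-∪ : ∀ S S′ → glue h (S ∪ S′) ≡ toℚ (h (take n S ∪ take n S′) (drop n S ∪ drop n S′))
  glue-∪ S S′ = cong₂ (λ A z → toℚ (h A z)) (take-zipWith _∨_ S S′) (drop-zipWith _∨_ S S′)

  glue-∩ : ∀ S S′ → glue h (S ∩ S′) ≡ toℚ (h (take n S ∩ take n S′) (drop n S ∩ drop n S′))
  glue-∩ S S′ = cong₂ (λ A z → toℚ (h A z)) (take-zipWith _∧_ S S′) (drop-zipWith _∧_ S S′)

  glue-monotone : ∀ S S′ → S ⊆ S′ → glue h S ℚ.≤ glue h S′
  glue-monotone S S′ S⊆S′ = begin
    glue h S                                              ≤⟨ toℚ-mono-≤ (h-increasing _ _ _ _) ⟩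
    toℚ (h (take n S ∪ take n S′) (drop n S ∪ drop n S′)) ≡⟨ glue-∪ S S′ ⟨
    glue h (S ∪ S′)                                       ≡⟨ cong (glue h) (⊆⇒∪≡ S⊆S′) ⟩
    glue h S′                                             ∎
    where open ℚP.≤-Reasoning

  glue-submodular : ∀ S S′ → glue h (S ∪ S′) ℚ.+ glue h (S ∩ S′) ℚ.≤ glue h S ℚ.+ glue h S′
  glue-submodular S S′ = begin
    glue h (S ∪ S′) ℚ.+ glue h (S ∩ S′)                     ≡⟨ cong₂ ℚ._+_ (glue-∪ S S′) (glue-∩ S S′) ⟩
    toℚ (h (A ∪ B) (z ∪ w)) ℚ.+ toℚ (h (A ∩ B) (z ∩ w))    ≡⟨ toℚ-+ (h (A ∪ B) (z ∪ w)) (h (A ∩ B) (z ∩ w)) ⟨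
    toℚ (h (A ∪ B) (z ∪ w) + h (A ∩ B) (z ∩ w))             ≤⟨ toℚ-mono-≤ (h-submodular A B z w) ⟩
    toℚ (h A z + h B w)                                     ≡⟨ toℚ-+ (h A z) (h B w) ⟩
    glue h S ℚ.+ glue h S′                                  ∎
    where
    open ℚP.≤-Reasoning
    A B : Subset n
    A = take n S
    B = take n S′
    z w : Subset m
    z = drop n S
    w = drop n S′

extendedRank : (Subset n → ℕ) → (Subset n → ℕ) → Subset n → Subset 1 → ℕ
extendedRank r t A (outside ∷ []) = r A
extendedRank r t A (inside ∷ [])  = t A

record IsSingleElementExtension (r t : Subset n → ℕ) : Set where
  field
    monotone          : IsMonotone t
    submodular        : IsSubmodular t
    rank≤             : ∀ A → r A ≤ t A
    submodular-mixed  : ∀ A B → t (A ∪ B) + r (A ∩ B) ≤ t A + r B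

module SingleElementExtension {r t : Subset n → ℕ} (r-⊥ : r ⊥ ≡ 0)
  (r-monotone : IsMonotone r) (r-submodular : IsSubmodular r)
  (t-extends : IsSingleElementExtension r t) where

  open IsSingleElementExtension t-extends

  extendedRank-increasing : ∀ A B z w → extendedRank r t A z ≤ extendedRank r t (A ∪ B) (z ∪ w)
  extendedRank-increasing A B (outside ∷ []) (outside ∷ []) = r-monotone _ _ (p⊆p∪q B)
  extendedRank-increasing A B (outside ∷ []) (inside ∷ [])  = ℕP.≤-trans (r-monotone _ _ (p⊆p∪q B)) (rank≤ (A ∪ B))
  extendedRank-increasing A B (inside ∷ [])  (_ ∷ [])       = monotone _ _ (p⊆p∪q B)

  extendedRank-submodular : ∀ A B z w →
    extendedRank r t (A ∪ B) (z ∪ w) + extendedRank r t (A ∩ B) (z ∩ w) ≤ extendedRank r t A z + extendedRank r t B w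
  extendedRank-submodular A B (outside ∷ []) (outside ∷ []) = r-submodular A B
  extendedRank-submodular A B (inside ∷ [])  (outside ∷ []) = submodular-mixed A B
  extendedRank-submodular A B (outside ∷ []) (inside ∷ [])  =
    subst₂ _≤_ (cong₂ (λ X Y → t X + r Y) (∪-comm B A) (∩-comm B A)) (ℕP.+-comm (t B) (r A))
      (submodular-mixed B A)
  extendedRank-submodular A B (inside ∷ [])  (inside ∷ [])  = submodular A B

  extension : Subset (n + 1) → ℚ
  extension = glue (extendedRank r t)

  extension-embedQ : ∀ A → extension (embedQ A) ≡ toℚ (r A)
  extension-embedQ A = glue-++ (extendedRank r t) A (outside ∷ [])

  extension-embedQ-∪ : ∀ A B → extension (embedQ A ∪ embedQ B) ≡ toℚ (r (A ∪ B))
  extension-embedQ-∪ A B =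
    trans (cong extension (zipWith-++ _∨_ A (outside ∷ []) B (outside ∷ []))) (extension-embedQ (A ∪ B))

  extension-Z∪embedQ : ∀ A → extension (Zset n 1 ∪ embedQ A) ≡ toℚ (t A)
  extension-Z∪embedQ A = begin
    extension (Zset n 1 ∪ embedQ A)          ≡⟨ cong extension (zipWith-++ _∨_ ⊥ (inside ∷ []) A (outside ∷ [])) ⟩
    extension ((⊥ ∪ A) ++ (inside ∷ []))     ≡⟨ glue-++ (extendedRank r t) (⊥ ∪ A) (inside ∷ []) ⟩
    toℚ (t (⊥ ∪ A))                          ≡⟨ cong (λ B → toℚ (t B)) (∪-identityˡ A) ⟩
    toℚ (t A)                                ∎
    where open ≡-Reasoning

  extension-isExtension : IsExtension r extension
  extension-isExtension =
    glue-isPolymatroid (extendedRank r t) r-⊥ extendedRank-increasing extendedRank-submodular ,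
    extension-embedQ

  extension-isCIExtension : ∀ {X Y} → t X ≡ r X → t Y ≡ r Y → t ⊥ + r (X ∪ Y) ≡ r X + r Y →
                            IsCIExtension r extension X Y
  extension-isCIExtension {X} {Y} tX≡rX tY≡rY modular =
    extension-isExtension , conditional-vanishes tX≡rX , conditional-vanishes tY≡rY , common-information
    where
    open ≡-Reasoning

    conditional-vanishes : ∀ {H} → t H ≡ r H → extension (Zset n 1 ∪ embedQ H) - extension (embedQ H) ≡ ℚ.0ℚ
    conditional-vanishes {H} tH≡rH = begin
      extension (Zset n 1 ∪ embedQ H) - extension (embedQ H) ≡⟨ cong₂ _-_ (extension-Z∪embedQ H) (extension-embedQ H) ⟩
      toℚ (t H) - toℚ (r H)                                  ≡⟨ cong (λ x → toℚ x - toℚ (r H)) tH≡rH ⟩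
      toℚ (r H) - toℚ (r H)                                  ≡⟨ ℚP.+-inverseʳ (toℚ (r H)) ⟩
      ℚ.0ℚ                                                   ∎

    common-information : extension (Zset n 1) ≡
      (extension (embedQ X) ℚ.+ extension (embedQ Y)) - extension (embedQ X ∪ embedQ Y)
    common-information = begin
      extension (Zset n 1)                    ≡⟨ glue-++ (extendedRank r t) ⊥ (inside ∷ []) ⟩
      toℚ (t ⊥)                               ≡⟨ toℚ-cancel (t ⊥) (r (X ∪ Y)) modular ⟩
      toℚ (r X + r Y) - toℚ (r (X ∪ Y))       ≡⟨ cong (_- toℚ (r (X ∪ Y))) (toℚ-+ (r X) (r Y)) ⟩
      (toℚ (r X) ℚ.+ toℚ (r Y)) - toℚ (r (X ∪ Y))
        ≡⟨ cong₂ _-_ (cong₂ ℚ._+_ (extension-embedQ X) (extension-embedQ Y)) (extension-embedQ-∪ X Y) ⟨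
      (extension (embedQ X) ℚ.+ extension (embedQ Y)) - extension (embedQ X ∪ embedQ Y) ∎

module RankFunction {r : Subset n → ℕ} (r-monotone : IsMonotone r) (r-submodular : IsSubmodular r) where

  open ℕP.≤-Reasoning

  submodular-⊆ : ∀ {P Q X Y} → P ⊆ X ∪ Y → Q ⊆ X ∩ Y → r P + r Q ≤ r X + r Y
  submodular-⊆ {P} {Q} {X} {Y} P⊆X∪Y Q⊆X∩Y =
    ℕP.≤-trans (ℕP.+-mono-≤ (r-monotone P (X ∪ Y) P⊆X∪Y) (r-monotone Q (X ∩ Y) Q⊆X∩Y)) (r-submodular X Y)

  shifted : Subset n → ℕ → Subset n → ℕ
  shifted F c A = c + r (A ∪ F)

  shifted-monotone : ∀ F c → IsMonotone (shifted F c)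
  shifted-monotone F c A B A⊆B = ℕP.+-monoʳ-≤ c (r-monotone _ _ (∪-mono-⊆ A⊆B ⊆-refl))

  rank≤shifted : ∀ F c A → r A ≤ shifted F c A
  rank≤shifted F c A = ℕP.≤-trans (r-monotone _ _ (p⊆p∪q F)) (ℕP.m≤n+m _ c)

  shifted-cross : ∀ {U V X Y cU cV cX cY} → U ⊆ X ∪ Y → V ⊆ X ∩ Y → cU + cV ≤ cX + cY → ∀ A B →
                  shifted U cU (A ∪ B) + shifted V cV (A ∩ B) ≤ shifted X cX A + shifted Y cY B
  shifted-cross {U} {V} {X} {Y} {cU} {cV} {cX} {cY} U⊆X∪Y V⊆X∩Y costs A B = begin
    (cU + r ((A ∪ B) ∪ U)) + (cV + r ((A ∩ B) ∪ V)) ≡⟨ interchange cU _ cV _ ⟩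
    (cU + cV) + (r ((A ∪ B) ∪ U) + r ((A ∩ B) ∪ V)) ≤⟨ ℕP.+-mono-≤ costs (submodular-⊆ ∪-part ∩-part) ⟩
    (cX + cY) + (r (A ∪ X) + r (B ∪ Y))             ≡⟨ interchange cX cY _ _ ⟩
    (cX + r (A ∪ X)) + (cY + r (B ∪ Y))             ∎
    where
    ∪-part : (A ∪ B) ∪ U ⊆ (A ∪ X) ∪ (B ∪ Y)
    ∪-part = ∪-least (∪-mono-⊆ (p⊆p∪q X) (p⊆p∪q Y)) (⊆-trans U⊆X∪Y (∪-mono-⊆ (q⊆p∪q A X) (q⊆p∪q B Y)))
    ∩-part : (A ∩ B) ∪ V ⊆ (A ∪ X) ∩ (B ∪ Y)
    ∩-part = ∪-least (∩-mono-⊆ (p⊆p∪q X) (p⊆p∪q Y)) (⊆-trans V⊆X∩Y (∩-mono-⊆ (q⊆p∪q A X) (q⊆p∪q B Y)))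

  shifted-mixed : ∀ F c A B → shifted F c (A ∪ B) + r (A ∩ B) ≤ shifted F c A + r B
  shifted-mixed F c A B = begin
    (c + r ((A ∪ B) ∪ F)) + r (A ∩ B) ≡⟨ ℕP.+-assoc c _ _ ⟩
    c + (r ((A ∪ B) ∪ F) + r (A ∩ B)) ≤⟨ ℕP.+-monoʳ-≤ c (submodular-⊆ ∪-part (∩-mono-⊆ (p⊆p∪q F) ⊆-refl)) ⟩
    c + (r (A ∪ F) + r B)             ≡⟨ ℕP.+-assoc c _ _ ⟨
    (c + r (A ∪ F)) + r B             ∎
    where
    ∪-part : (A ∪ B) ∪ F ⊆ (A ∪ F) ∪ B
    ∪-part = ∪-least (∪-mono-⊆ (p⊆p∪q F) ⊆-refl) (⊆-trans (q⊆p∪q A F) (p⊆p∪q B))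

  hyperplane-⊆-or-spanning : ∀ {H} → IsHyperplane r H → ∀ A → A ⊆ H ⊎ r ⊤ ≤ r (A ∪ H)
  hyperplane-⊆-or-spanning {H} (H-flat , H-corank₁) A with nonempty? (A ∩ ∁ H)
  ... | yes (x , x∈A∖H) = inj₂ (begin
    r ⊤           ≡⟨ H-corank₁ ⟨
    r H + 1       ≡⟨ ℕP.+-comm (r H) 1 ⟩
    suc (r H)     ≤⟨ H-flat x (x∈∁p⇒x∉p (p∩q⊆q A (∁ H) x∈A∖H)) ⟩
    r (H ∪ ⁅ x ⁆) ≤⟨ r-monotone _ _ (∪-least (q⊆p∪q A H) (⊆-trans (x∈p⇒⁅x⁆⊆p (p∩q⊆p A (∁ H) x∈A∖H)) (p⊆p∪q H))) ⟩
    r (A ∪ H)     ∎)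
  ... | no A∖H-empty = inj₁ A⊆H
    where
    A⊆H : A ⊆ H
    A⊆H {x} x∈A with x ∈? H
    ... | yes x∈H = x∈H
    ... | no x∉H  = contradiction (x , x∈p∩q⁺ (x∈A , x∉p⇒x∈∁p x∉H)) A∖H-empty

  hyperplane-cross : ∀ {P Q} → IsHyperplane r P → IsHyperplane r Q → (f : Subset n → ℕ) →
    (∀ X → f X ≤ r (X ∪ P)) → (∀ X → f X ≤ r (X ∪ Q)) →
    (∀ X → X ⊆ P ∩ Q → f X + r (P ∪ Q) ≤ r P + r Q) →
    ∀ A B → f (A ∪ B) + f (A ∩ B) ≤ r (A ∪ P) + r (B ∪ Q)
  hyperplane-cross {P} {Q} P-hyperplane Q-hyperplane f f≤P f≤Q f≤meet A B
    with hyperplane-⊆-or-spanning P-hyperplane A | hyperplane-⊆-or-spanning Q-hyperplane B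
  ... | inj₂ A-spans | _ = ℕP.+-mono-≤
    (ℕP.≤-trans (ℕP.≤-trans (f≤P _) (r-monotone _ _ ⊆⊤)) A-spans)
    (ℕP.≤-trans (f≤Q _) (r-monotone _ _ (∪-mono-⊆ (p∩q⊆q A B) ⊆-refl)))
  ... | inj₁ _ | inj₂ B-spans = begin
    f (A ∪ B) + f (A ∩ B) ≡⟨ ℕP.+-comm (f (A ∪ B)) _ ⟩
    f (A ∩ B) + f (A ∪ B) ≤⟨ ℕP.+-mono-≤ (ℕP.≤-trans (f≤P _) (r-monotone _ _ (∪-mono-⊆ (p∩q⊆p A B) ⊆-refl)))
                                         (ℕP.≤-trans (ℕP.≤-trans (f≤P _) (r-monotone _ _ ⊆⊤)) B-spans) ⟩
    r (A ∪ P) + r (B ∪ Q) ∎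
  ... | inj₁ A⊆P | inj₁ B⊆Q = begin
    f (A ∪ B) + f (A ∩ B) ≤⟨ ℕP.+-monoˡ-≤ _ (ℕP.≤-trans (f≤P _) (r-monotone _ _ (∪-least (∪-mono-⊆ A⊆P B⊆Q) (p⊆p∪q Q)))) ⟩
    r (P ∪ Q) + f (A ∩ B) ≡⟨ ℕP.+-comm (r (P ∪ Q)) _ ⟩
    f (A ∩ B) + r (P ∪ Q) ≤⟨ f≤meet (A ∩ B) (∩-mono-⊆ A⊆P B⊆Q) ⟩
    r P + r Q             ≤⟨ ℕP.+-mono-≤ (r-monotone _ _ (q⊆p∪q A P)) (r-monotone _ _ (q⊆p∪q B Q)) ⟩
    r (A ∪ P) + r (B ∪ Q) ∎

module HyperplaneCI {r : Subset n → ℕ} (M : IsMatroid r) {H₁ H₂ : Subset n}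
                    (H₁-hyperplane : IsHyperplane r H₁) (H₂-hyperplane : IsHyperplane r H₂) where

  open IsMatroid M
  open RankFunction monotone submodular
  open ℕP.≤-Reasoning

  T : Subset n
  T = H₁ ∩ H₂

  k : ℕ
  k = r H₁ + r H₂ ∸ r (H₁ ∪ H₂)

  k+r[H₁∪H₂]≡ : k + r (H₁ ∪ H₂) ≡ r H₁ + r H₂
  k+r[H₁∪H₂]≡ = ℕP.m∸n+n≡m (ℕP.m+n≤o⇒m≤o (r (H₁ ∪ H₂)) (submodular H₁ H₂))

  r[T]≤k : r T ≤ k
  r[T]≤k = ℕP.m+n≤o⇒m≤o∸n (r T) (subst (_≤ r H₁ + r H₂) (ℕP.+-comm _ (r T)) (submodular H₁ H₂))

  k≤r[H₁] : k ≤ r H₁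
  k≤r[H₁] = ℕP.m≤n+o⇒m∸n≤o _ _ (begin
    r H₁ + r H₂         ≤⟨ ℕP.+-monoʳ-≤ (r H₁) (monotone _ _ (q⊆p∪q H₁ H₂)) ⟩
    r H₁ + r (H₁ ∪ H₂)  ≡⟨ ℕP.+-comm (r H₁) _ ⟩
    r (H₁ ∪ H₂) + r H₁  ∎)

  k≤r[H₂] : k ≤ r H₂
  k≤r[H₂] = ℕP.m≤n+o⇒m∸n≤o _ _ (ℕP.+-monoˡ-≤ (r H₂) (monotone _ _ (p⊆p∪q H₂)))

  data Bound : Set where
    via-T via-H₁ via-H₂ : Bound

  flatOf : Bound → Subset n
  flatOf via-T  = T
  flatOf via-H₁ = H₁
  flatOf via-H₂ = H₂

  costOf : Bound → ℕ
  costOf via-T  = k ∸ r T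
  costOf via-H₁ = 0
  costOf via-H₂ = 0

  bound : Bound → Subset n → ℕ
  bound i = shifted (flatOf i) (costOf i)

  t : Subset n → ℕ
  t A = bound via-T A ⊓ (bound via-H₁ A ⊓ bound via-H₂ A)

  t≤bound : ∀ i A → t A ≤ bound i A
  t≤bound via-T  A = ℕP.m⊓n≤m _ _
  t≤bound via-H₁ A = ℕP.≤-trans (ℕP.m⊓n≤n _ _) (ℕP.m⊓n≤m _ _)
  t≤bound via-H₂ A = ℕP.≤-trans (ℕP.m⊓n≤n _ _) (ℕP.m⊓n≤n _ _)

  ≤t : ∀ {x A} → (∀ i → x ≤ bound i A) → x ≤ t A
  ≤t x≤ = ℕP.⊓-glb (x≤ via-T) (ℕP.⊓-glb (x≤ via-H₁) (x≤ via-H₂))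

  ≤t+ : ∀ {x A} y → (∀ i → x ≤ bound i A + y) → x ≤ t A + y
  ≤t+ {x} {A} y x≤ = subst (x ≤_) (sym distrib) (ℕP.⊓-glb (x≤ via-T) (ℕP.⊓-glb (x≤ via-H₁) (x≤ via-H₂)))
    where
    distrib : t A + y ≡ (bound via-T A + y) ⊓ ((bound via-H₁ A + y) ⊓ (bound via-H₂ A + y))
    distrib = trans (ℕP.+-distribʳ-⊓ y _ _) (cong ((bound via-T A + y) ⊓_) (ℕP.+-distribʳ-⊓ y _ _))

  ≤+t : ∀ {x B} y → (∀ j → x ≤ y + bound j B) → x ≤ y + t B
  ≤+t {x} {B} y x≤ = subst (x ≤_) (ℕP.+-comm (t B) y) (≤t+ y λ j → subst (x ≤_) (ℕP.+-comm y _) (x≤ j))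

  t≤k : ∀ X → X ⊆ T → t X ≤ k
  t≤k X X⊆T = begin
    t X                    ≤⟨ t≤bound via-T X ⟩
    (k ∸ r T) + r (X ∪ T)  ≡⟨ cong (λ Y → (k ∸ r T) + r Y) (⊆⇒∪≡ X⊆T) ⟩
    (k ∸ r T) + r T        ≡⟨ ℕP.m∸n+n≡m r[T]≤k ⟩
    k                      ∎

  t-⊥ : t ⊥ ≡ k
  t-⊥ = ℕP.≤-antisym (t≤k ⊥ ⊥⊆) (≤t k≤bound)
    where
    k≤bound : ∀ i → k ≤ bound i ⊥
    k≤bound via-T  = ℕP.≤-reflexive (sym (trans (cong (λ Y → (k ∸ r T) + r Y) (∪-identityˡ T)) (ℕP.m∸n+n≡m r[T]≤k)))
    k≤bound via-H₁ = ℕP.≤-trans k≤r[H₁] (monotone _ _ (q⊆p∪q ⊥ H₁))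
    k≤bound via-H₂ = ℕP.≤-trans k≤r[H₂] (monotone _ _ (q⊆p∪q ⊥ H₂))

  rank≤t : ∀ A → r A ≤ t A
  rank≤t A = ≤t λ i → rank≤shifted (flatOf i) (costOf i) A

  t≡r-at-bound : ∀ {H} → (∀ X → t X ≤ r (X ∪ H)) → t H ≡ r H
  t≡r-at-bound {H} t≤ = ℕP.≤-antisym (subst (t H ≤_) (cong r (∪-idem H)) (t≤ H)) (rank≤t H)

  bounds-cross : ∀ i j p q → flatOf p ⊆ flatOf i ∪ flatOf j → flatOf q ⊆ flatOf i ∩ flatOf j →
                 costOf p + costOf q ≤ costOf i + costOf j →
                 ∀ A B → t (A ∪ B) + t (A ∩ B) ≤ bound i A + bound j B
  bounds-cross i j p q p⊆ q⊆ costs A B =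
    ℕP.≤-trans (ℕP.+-mono-≤ (t≤bound p (A ∪ B)) (t≤bound q (A ∩ B))) (shifted-cross {cU = costOf p} {cV = costOf q} {cX = costOf i} {cY = costOf j} p⊆ q⊆ costs A B)

  hyperplanes-cross : ∀ A B → t (A ∪ B) + t (A ∩ B) ≤ r (A ∪ H₁) + r (B ∪ H₂)
  hyperplanes-cross = hyperplane-cross H₁-hyperplane H₂-hyperplane t (t≤bound via-H₁) (t≤bound via-H₂)
    λ X X⊆T → ℕP.≤-trans (ℕP.+-monoˡ-≤ _ (t≤k X X⊆T)) (ℕP.≤-reflexive k+r[H₁∪H₂]≡)

  bounds-pair : ∀ i j A B → t (A ∪ B) + t (A ∩ B) ≤ bound i A + bound j B
  bounds-pair via-T   via-T  = bounds-cross via-T via-T via-T via-T (p⊆p∪q T) (∩-greatest ⊆-refl ⊆-refl) ℕP.≤-refl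
  bounds-pair via-H₁  via-H₁ = bounds-cross via-H₁ via-H₁ via-H₁ via-H₁ (p⊆p∪q H₁) (∩-greatest ⊆-refl ⊆-refl) ℕP.≤-refl
  bounds-pair via-H₂  via-H₂ = bounds-cross via-H₂ via-H₂ via-H₂ via-H₂ (p⊆p∪q H₂) (∩-greatest ⊆-refl ⊆-refl) ℕP.≤-refl
  bounds-pair via-T   via-H₁ = bounds-cross via-T via-H₁ via-H₁ via-T (q⊆p∪q T H₁) (∩-greatest ⊆-refl (p∩q⊆p H₁ H₂))
                                (ℕP.≤-reflexive (sym (ℕP.+-identityʳ _)))
  bounds-pair via-H₁  via-T  = bounds-cross via-H₁ via-T via-H₁ via-T (p⊆p∪q T) (∩-greatest (p∩q⊆p H₁ H₂) ⊆-refl) ℕP.≤-refl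
  bounds-pair via-T   via-H₂ = bounds-cross via-T via-H₂ via-H₂ via-T (q⊆p∪q T H₂) (∩-greatest ⊆-refl (p∩q⊆q H₁ H₂))
                                (ℕP.≤-reflexive (sym (ℕP.+-identityʳ _)))
  bounds-pair via-H₂  via-T  = bounds-cross via-H₂ via-T via-H₂ via-T (p⊆p∪q T) (∩-greatest (p∩q⊆q H₁ H₂) ⊆-refl) ℕP.≤-refl
  bounds-pair via-H₁ via-H₂ = hyperplanes-cross
  bounds-pair via-H₂ via-H₁ A B =
    subst₂ _≤_ (cong₂ (λ X Y → t X + t Y) (∪-comm B A) (∩-comm B A)) (ℕP.+-comm (r (B ∪ H₁)) _)
      (hyperplanes-cross B A)

  t-isSingleElementExtension : IsSingleElementExtension r t
  t-isSingleElementExtension = record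
    { monotone         = λ A B A⊆B → ≤t λ i → ℕP.≤-trans (t≤bound i A) (shifted-monotone _ _ A B A⊆B)
    ; submodular       = λ A B → ≤t+ (t B) λ i → ≤+t (bound i A) λ j → bounds-pair i j A B
    ; rank≤            = rank≤t
    ; submodular-mixed = λ A B → ≤t+ (r B) λ i →
        ℕP.≤-trans (ℕP.+-monoˡ-≤ _ (t≤bound i (A ∪ B))) (shifted-mixed (flatOf i) (costOf i) A B)
    }

  t-H₁ : t H₁ ≡ r H₁
  t-H₁ = t≡r-at-bound (t≤bound via-H₁)

  t-H₂ : t H₂ ≡ r H₂
  t-H₂ = t≡r-at-bound (t≤bound via-H₂)

  t-⊥-modular : t ⊥ + r (H₁ ∪ H₂) ≡ r H₁ + r H₂
  t-⊥-modular = trans (cong (_+ r (H₁ ∪ H₂)) t-⊥) k+r[H₁∪H₂]≡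

matroid-normalized : {r : Subset n → ℕ} → IsMatroid r → r ⊥ ≡ 0
matroid-normalized {n} {r} M = ℕP.n≤0⇒n≡0 (subst (r ⊥ ≤_) (∣⊥∣≡0 n) (IsMatroid.bounded M ⊥))

lemma5p6 : (n : ℕ) (r : Subset n → ℕ) → IsMatroid r →
           (H₁ H₂ : Subset n) → IsHyperplane r H₁ → IsHyperplane r H₂ →
           HasCIExtension r H₁ H₂
lemma5p6 n r M H₁ H₂ H₁-hyperplane H₂-hyperplane =
  1 , extension , extension-isCIExtension t-H₁ t-H₂ t-⊥-modular
  where
  open IsMatroid M
  open HyperplaneCI M H₁-hyperplane H₂-hyperplane
  open SingleElementExtension (matroid-normalized M) monotone submodular t-isSingleElementExtension
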